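{- Let $k\ge 2$, $1\le c\le k-1$, and $n>4k+2$ such that there are pairwise coprime integers $P_1,\dots,P_k\in[n,2n]$. The formula $\tau(G)$ described in the context has a resolution refutation of width $k+3$ and size $O((L+r)2^kk)$.
   Context: Indices of $P_j$ and of rows are cyclic mod $k$. Set $m_i=2(k+c)\prod_{j=i}^{i+c}P_j$, $L=2(k+c)P_1\cdots P_k$, $r=k+c+1$. $G$ is the cylinder with rows $[k]$ and columns $[L+2r]$: vertices $(i,a)$, horizontal edges $\{(i,a),(i,a+1)\}$, vertical edges $\{(i,a),(i+1,a)\}$ (rows cyclic; for $k=2$ one vertical edge per column). Vertex equivalence: $(i,a)\equiv_V(j,b)$ iff $i=j$ and ($a=b$, or $a,b\in[r+1,r+L]$ and $a\equiv b\pmod{m_i}$). Neighbors are ordered left, right, up, down (omitting non-existent ones); $\equiv_E$ is the transitive closure of: $\{v_1,w_1\}\sim\{v_2,w_2\}$ whenever $v_1\equiv_V v_2$ and $w_1$ has the same position in $v_1$'s neighbor list as $w_2$ in $v_2$'s. $\mathrm{Ts}(G)$ is the Tseitin formula on $G$ (a variable $x_e$ per edge and, for each vertex $v$, the clauses expressing that $\sum_{e\ni v}x_e$ is odd if $v=(1,1)$ and even otherwise), and $\tau(G)$ is obtained by replacing each $x_e$ by a single variable for the $\equiv_E$-class of $e$. Width is the maximal clause width, size the number of clauses in the refutation. -}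

module Defs where

open import Data.Nat using (ℕ; zero; suc; _+_; _*_; _∸_; _≤_; _<_; _≡ᵇ_; _<ᵇ_; _%_)
open import Data.Nat.Divisibility using (_∣_)
open import Data.Bool using (Bool; true; false; not; if_then_else_; _∧_; _∨_; _xor_)
open import Data.List using (List; []; _∷_; _++_; map; concatMap; length; upTo; filterᵇ; zipWith; foldr)
open import Data.Nat.ListAction using (product)
open import Data.List.Membership.Propositional using (_∈_)
open import Data.List.Relation.Unary.All using (All)
open import Data.List.Relation.Unary.Unique.Propositional using (Unique)
open import Data.Product using (_×_; _,_; Σ; ∃; ∃-syntax; proj₁; proj₂)
open import Data.Sum using (_⊎_)
open import Relation.Binary.PropositionalEquality using (_≡_; _≢_)
open import Relation.Binary.Construct.Closure.Transitive using (TransClosure)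
open import Function.Bundles using (_⇔_)

from : ℕ → ℕ → List ℕ
from i len = map (i +_) (upTo len)

range1 : ℕ → List ℕ
range1 n = from 1 n

-- j mod k (with the convention j mod 0 = 0, irrelevant since k ≥ 2)
cyc : ℕ → ℕ → ℕ
cyc zero    j = 0
cyc (suc k) j = j % suc k

_≡_[mod_] : ℕ → ℕ → ℕ → Set
a ≡ b [mod m ] = (m ∣ (a ∸ b)) × (m ∣ (b ∸ a))

data At {A : Set} : List A → ℕ → A → Set where
  here  : ∀ {x xs} → At (x ∷ xs) 0 x
  there : ∀ {x y xs j} → At xs j y → At (x ∷ xs) (suc j) y

allBools : ℕ → List (List Bool)
allBools zero    = [] ∷ []
allBools (suc d) = concatMap (λ bs → (false ∷ bs) ∷ (true ∷ bs) ∷ []) (allBools d)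

parity : List Bool → Bool
parity = foldr _xor_ false

-- literal (x , true) is the variable x, (x , false) is ¬x
Literal : Set
Literal = ℕ × Bool

Clause : Set
Clause = List Literal

CNF : Set
CNF = List Clause

-- clauses are sets of literals: set equality of lists
_≈ₛ_ : Clause → Clause → Set
C ≈ₛ D = ∀ l → (l ∈ C) ⇔ (l ∈ D)

Resolvent : ℕ → Clause → Clause → Clause → Set
Resolvent x C D E =
  ((x , true) ∈ C) × ((x , false) ∈ D) ×
  (∀ l → (l ∈ E) ⇔ (((l ∈ C) × (l ≢ (x , true))) ⊎ ((l ∈ D) × (l ≢ (x , false)))))

data Line (F : CNF) (prev : List Clause) (E : Clause) : Set where
  axiom : (A : Clause) → A ∈ F → E ≈ₛ A → Line F prev E
  res   : (x : ℕ) (C D : Clause) → C ∈ prev → D ∈ prev → Resolvent x C D E → Line F prev E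

-- a resolution derivation from F; the list is stored newest line first.
-- Each line is a duplicate-free list, so its width is its length.
data Derivation (F : CNF) : List Clause → Set where
  []  : Derivation F []
  _▹_ : ∀ {cs E} → Derivation F cs → Line F cs E × Unique E → Derivation F (E ∷ cs)

HasRefutation : CNF → (w s : ℕ) → Set
HasRefutation F w s =
  Σ (List Clause) λ cs → Derivation F cs × ([] ∈ cs) × (length cs ≤ s) ×
                          All (λ C → length C ≤ w) cs

-- The cylinder G and the formula τ(G), for parameters k, c and
-- P : ℕ → ℕ (only P 1, …, P k are used).

Vertex : Set
Vertex = ℕ × ℕ     -- (row i , column a), 1-based

Edge : Set
Edge = Vertex × Vertex

module Cyl (k c : ℕ) (P : ℕ → ℕ) where

  -- P_j with j cyclic mod k
  Pc : ℕ → ℕ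
  Pc j = P (suc (cyc k (j ∸ 1)))

  m : ℕ → ℕ
  m i = 2 * (k + c) * product (map Pc (from i (suc c)))

  L : ℕ
  L = 2 * (k + c) * product (map P (range1 k))

  r : ℕ
  r = k + c + 1

  N : ℕ
  N = L + 2 * r

  up : ℕ → ℕ
  up i = if i ≡ᵇ 1 then k else i ∸ 1

  down : ℕ → ℕ
  down i = if i ≡ᵇ k then 1 else suc i

  vertices : List Vertex
  vertices = concatMap (λ i → map (λ a → (i , a)) (range1 N)) (range1 k)

  -- horizontal edges, vertical edges {(i,a),(i+1,a)} for i < k, and the
  -- wrap-around edges {(k,a),(1,a)} (only for k ≥ 3: for k = 2 there is
  -- one vertical edge per column)
  edges : List Edge
  edges =
    concatMap (λ i → map (λ a → ((i , a) , (i , suc a))) (range1 (N ∸ 1))) (range1 k) ++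
    concatMap (λ i → map (λ a → ((i , a) , (suc i , a))) (range1 N)) (range1 (k ∸ 1)) ++
    (if 2 <ᵇ k then map (λ a → ((k , a) , (1 , a))) (range1 N) else [])

  -- neighbours in the order left, right, up, down (non-existent ones omitted;
  -- for k = 2 the unique vertical neighbour is listed once)
  nbrs : Vertex → List Vertex
  nbrs (i , a) =
    (if 1 <ᵇ a then (i , a ∸ 1) ∷ [] else []) ++
    (if a <ᵇ N then (i , suc a) ∷ [] else []) ++
    ((up i , a) ∷ []) ++
    (if k ≡ᵇ 2 then [] else (down i , a) ∷ [])

  inMiddle : ℕ → Set
  inMiddle a = (suc r ≤ a) × (a ≤ r + L)

  _≡V_ : Vertex → Vertex → Set
  (i , a) ≡V (j , b) = (i ≡ j) × ((a ≡ b) ⊎ (inMiddle a × inMiddle b × (a ≡ b [mod m i ])))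

  -- one generating step of ≡_E (edges are unordered: either orientation)
  Step : Edge → Edge → Set
  Step e e' =
    (e ∈ edges) × (e' ∈ edges) ×
    ∃[ v₁ ] ∃[ w₁ ] ∃[ v₂ ] ∃[ w₂ ]
      (((v₁ , w₁) ≡ e) ⊎ ((w₁ , v₁) ≡ e)) ×
      (((v₂ , w₂) ≡ e') ⊎ ((w₂ , v₂) ≡ e')) ×
      (v₁ ≡V v₂) ×
      (∃[ j ] (At (nbrs v₁) j w₁ × At (nbrs v₂) j w₂))

  _≡E_ : Edge → Edge → Set
  _≡E_ = TransClosure Step

  IsClassLabelling : (Edge → ℕ) → Set
  IsClassLabelling f = ∀ e e' → e ∈ edges → e' ∈ edges → (f e ≡ f e') ⇔ (e ≡E e')

  isV : Vertex → Vertex → Bool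
  isV (i , a) (j , b) = (i ≡ᵇ j) ∧ (a ≡ᵇ b)

  incident : Vertex → List Edge
  incident v = filterᵇ (λ e → isV (proj₁ e) v ∨ isV (proj₂ e) v) edges

  charge : Vertex → Bool
  charge v = isV v (1 , 1)

  -- Tseitin clauses of vertex v with edge variables renamed by f:
  -- one clause excluding each assignment α of the wrong parity
  vertexClauses : (Edge → ℕ) → Vertex → CNF
  vertexClauses f v =
    map (λ α → zipWith (λ e b → (f e , not b)) (incident v) α)
        (filterᵇ (λ α → not (parity α ≡ᵇᵇ charge v)) (allBools (length (incident v))))
    where
      _≡ᵇᵇ_ : Bool → Bool → Bool
      true  ≡ᵇᵇ b = b
      false ≡ᵇᵇ b = not b

  -- τ(G): Ts(G) with x_e replaced by the variable f e of the class of e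
  τ : (Edge → ℕ) → CNF
  τ f = concatMap (vertexClauses f) vertices

-- The refutation sweeps the cylinder one vertex at a time, column by column and top to bottom.
-- When a region R (the first j columns and the top t vertices of column j + 1) has been swept,
-- the derived clauses imply the parity constraint "the variables of the edges leaving R sum to the
-- charge of R", in the sense that every assignment violating it falsifies a derived clause over
-- those at most k + 2 variables. Adding the next vertex v adds its Tseitin constraint (at most four
-- variables) to this one; the variables that leave the cut are eliminated by a resolution decision
-- tree whose clauses mention only the new cut and the branched variables, at most k + 3 of them.
-- Each vertex costs O(2^k) clauses; at the end the cut is empty while R contains the odd vertex
-- (1 , 1), which gives the empty clause. Only parities of variable lists matter, and repeated
-- variables cancel.

module Submission where

open import Defs
open import Algebra.Bundles using (CommutativeRing)
open import Data.Bool using (Bool; true; false; not; _xor_; _∧_; _∨_; T; if_then_else_)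
open import Data.Bool.Properties
  using (T-≡; T-∧; T-∨; ¬-not; not-injective; ∧-zeroʳ; ∧-identityʳ; xor-identityʳ; ∧-distribʳ-xor; xor-∧-commutativeRing)
  renaming (_≟_ to _≟ᵇ_)
open import Data.Empty using (⊥-elim)
open import Data.List
  using (List; []; _∷_; _++_; map; length; filter; filterᵇ; concatMap; upTo; zipWith; deduplicate; cartesianProductWith)
open import Data.List.Properties
  using (length-++; length-++-sucʳ; length-map; length-upTo; length-filter; filter-none; map-cong-local)
open import Data.List.Membership.Propositional using (_∈_; _∉_)
open import Data.List.Membership.Propositional.Properties
  using (∈-∃++; ∈-++⁺ˡ; ∈-++⁺ʳ; ∈-++⁻; ∈-map⁺; ∈-map⁻; ∈-concatMap⁺; ∈-upTo⁺; ∈-upTo⁻; ∈-filter⁺; ∈-filter⁻;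
         ∈-cartesianProductWith⁺; ∈-cartesianProductWith⁻; deduplicate-∈⇔)
open import Data.List.Relation.Binary.Disjoint.Propositional using (Disjoint)
open import Data.List.Relation.Binary.Subset.Propositional using (_⊆_)
open import Data.List.Relation.Unary.All as All using (All; []; _∷_)
open import Data.List.Relation.Unary.AllPairs using ([]; _∷_)
open import Data.List.Relation.Unary.Any as Any using (here; there)
open import Data.List.Relation.Unary.Unique.Propositional using (Unique)
import Data.List.Relation.Unary.Unique.Propositional.Properties as Unique
open import Data.Nat using (ℕ; zero; suc; _+_; _*_; _^_; _∸_; _≤_; _<_; z≤n; s≤s; _≟_; _≤ᵇ_; _<ᵇ_; _≡ᵇ_)
open import Data.Nat.Coprimality using (Coprime)
open import Data.Nat.Properties
open import Data.Nat.Solver using (module +-*-Solver)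
open import Data.Product using (Σ; _×_; _,_; proj₁; proj₂; ∃-syntax; ∃₂)
open import Data.Product.Properties using (≡-dec)
open import Data.Sum using (_⊎_; inj₁; inj₂; [_,_])
open import Function using (_∘_; id; const; case_of_)
open import Function.Bundles using (mk⇔; Equivalence)
open import Function.Properties.Equivalence using () renaming (sym to ⇔-sym)
open import Relation.Binary.Definitions using (DecidableEquality; tri<; tri≈; tri>)
open import Relation.Binary.PropositionalEquality
  using (_≡_; _≢_; refl; sym; trans; cong; cong₂; subst; subst₂; module ≡-Reasoning)
open import Relation.Nullary using (¬_; ¬?; Dec; yes; no; contradiction)
open import Relation.Nullary.Decidable using (T?)

open import Algebra.Properties.CommutativeSemigroup (CommutativeRing.+-commutativeSemigroup xor-∧-commutativeRing)
  using () renaming (interchange to xor-interchange)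
open import Data.List.Membership.DecPropositional _≟_ using (_∈?_)
open import Data.List.Membership.DecPropositional (≡-dec _≟_ _≟ᵇ_) using () renaming (_∈?_ to _∈ₗ?_)
open import Data.List.Relation.Unary.Unique.DecPropositional.Properties (≡-dec _≟_ _≟ᵇ_) using (deduplicate-!)
open +-*-Solver using (solve; _:+_; _:*_; con; _:=_)

Unique-⊆⇒length≤ : ∀ {A : Set} {xs ys : List A} → Unique xs → xs ⊆ ys → length xs ≤ length ys
Unique-⊆⇒length≤ {xs = []} _ _ = z≤n
Unique-⊆⇒length≤ {xs = x ∷ xs} (x∉xs ∷ xs!) xs⊆ys with ∈-∃++ (xs⊆ys (here refl))
... | ys₁ , ys₂ , refl = begin
  suc (length xs)           ≤⟨ s≤s (Unique-⊆⇒length≤ xs! xs⊆ys₁++ys₂) ⟩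
  suc (length (ys₁ ++ ys₂)) ≡⟨ length-++-sucʳ ys₁ x ys₂ ⟨
  length (ys₁ ++ x ∷ ys₂)   ∎
  where
  open ≤-Reasoning
  xs⊆ys₁++ys₂ : xs ⊆ ys₁ ++ ys₂
  xs⊆ys₁++ys₂ {z} z∈xs with ∈-++⁻ ys₁ (xs⊆ys (there z∈xs))
  ... | inj₁ z∈ys₁         = ∈-++⁺ˡ z∈ys₁
  ... | inj₂ (here refl)   = contradiction refl (All.lookup x∉xs z∈xs)
  ... | inj₂ (there z∈ys₂) = ∈-++⁺ʳ ys₁ z∈ys₂

_≟ₗ_ : DecidableEquality Literal
_≟ₗ_ = ≡-dec _≟_ _≟ᵇ_

xor-violation : ∀ a b p q → a xor b ≡ not (p xor q) → a ≡ not p ⊎ b ≡ not q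
xor-violation true  b false q _ = inj₁ refl
xor-violation false b true  q _ = inj₁ refl
xor-violation true  b true  q e = inj₂ (not-injective e)
xor-violation false b false q e = inj₂ e

parity-xor : ∀ {A : Set} (g h : A → Bool) xs →
             parity (map g xs) xor parity (map h xs) ≡ parity (map (λ x → g x xor h x) xs)
parity-xor g h []       = refl
parity-xor g h (x ∷ xs) = trans (xor-interchange (g x) _ (h x) _) (cong ((g x xor h x) xor_) (parity-xor g h xs))

Assignment : Set
Assignment = ℕ → Bool

falseLit : Assignment → ℕ → Literal
falseLit ρ x = x , not (ρ x)

FalsifiedWithin : Assignment → Clause → (ℕ → Set) → Set
FalsifiedWithin ρ D X = ∀ {l} → l ∈ D → ∃[ x ] l ≡ falseLit ρ x × X x

HasFalsified : List Clause → Assignment → (ℕ → Set) → Set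
HasFalsified cs ρ X = ∃[ D ] D ∈ cs × FalsifiedWithin ρ D X

parityOn : Assignment → List ℕ → Bool
parityOn ρ V = parity (map ρ V)

parityOn-filterᵇ : ∀ {A : Set} ρ (g : A → ℕ) p xs →
                   parityOn ρ (map g (filterᵇ p xs)) ≡ parity (map (λ x → p x ∧ ρ (g x)) xs)
parityOn-filterᵇ ρ g p []       = refl
parityOn-filterᵇ ρ g p (x ∷ xs) with p x
... | true  = cong (ρ (g x) xor_) (parityOn-filterᵇ ρ g p xs)
... | false = parityOn-filterᵇ ρ g p xs

parityOn-filterᵇ-xor : ∀ {A : Set} ρ (g : A → ℕ) (p q r : A → Bool) xs → (∀ {x} → x ∈ xs → r x ≡ p x xor q x) →
                       parityOn ρ (map g (filterᵇ p xs)) xor parityOn ρ (map g (filterᵇ q xs))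
                         ≡ parityOn ρ (map g (filterᵇ r xs))
parityOn-filterᵇ-xor ρ g p q r xs r≡p⊕q = begin
  parityOn ρ (map g (filterᵇ p xs)) xor parityOn ρ (map g (filterᵇ q xs))
    ≡⟨ cong₂ _xor_ (parityOn-filterᵇ ρ g p xs) (parityOn-filterᵇ ρ g q xs) ⟩
  parity (map (λ x → p x ∧ ρ (g x)) xs) xor parity (map (λ x → q x ∧ ρ (g x)) xs)
    ≡⟨ parity-xor _ _ xs ⟩
  parity (map (λ x → (p x ∧ ρ (g x)) xor (q x ∧ ρ (g x))) xs)
    ≡⟨ cong parity (map-cong-local (All.tabulate λ {x} x∈ →
         trans (sym (∧-distribʳ-xor (ρ (g x)) (p x) (q x))) (cong (_∧ ρ (g x)) (sym (r≡p⊕q x∈))))) ⟩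
  parity (map (λ x → r x ∧ ρ (g x)) xs)
    ≡⟨ parityOn-filterᵇ ρ g r xs ⟨
  parityOn ρ (map g (filterᵇ r xs)) ∎
  where open ≡-Reasoning

CatchesViolation : List Clause → List ℕ → Bool → Assignment → Set
CatchesViolation cs V p ρ = parityOn ρ V ≡ not p → HasFalsified cs ρ (_∈ V)

DerivesParity : List Clause → List ℕ → Bool → Set
DerivesParity cs V p = ∀ ρ → CatchesViolation cs V p ρ

module _ {ρ : Assignment} where

  FalsifiedWithin-weaken : ∀ {D} {X Y : ℕ → Set} → (∀ {x} → X x → Y x) → FalsifiedWithin ρ D X → FalsifiedWithin ρ D Y
  FalsifiedWithin-weaken X⇒Y falsified l∈D with falsified l∈D
  ... | x , l≡ , Xx = x , l≡ , X⇒Y Xx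

  FalsifiedWithin-length : ∀ {D V} → Unique D → FalsifiedWithin ρ D (_∈ V) → length D ≤ length V
  FalsifiedWithin-length {D} {V} D! falsified = begin
    length D                  ≤⟨ Unique-⊆⇒length≤ D! D⊆ ⟩
    length (map (falseLit ρ) V) ≡⟨ length-map (falseLit ρ) V ⟩
    length V                  ∎
    where
    open ≤-Reasoning
    D⊆ : D ⊆ map (falseLit ρ) V
    D⊆ l∈D with falsified l∈D
    ... | x , refl , x∈V = ∈-map⁺ (falseLit ρ) x∈V

  map-falseLit-falsified : ∀ V → FalsifiedWithin ρ (map (falseLit ρ) V) (_∈ V)
  map-falseLit-falsified V l∈ with ∈-map⁻ (falseLit ρ) l∈
  ... | x , x∈V , refl = x , refl , x∈V

  HasFalsified-weaken : ∀ {cs} {X Y : ℕ → Set} → (∀ {x} → X x → Y x) → HasFalsified cs ρ X → HasFalsified cs ρ Y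
  HasFalsified-weaken X⇒Y (D , D∈ , falsified) = D , D∈ , FalsifiedWithin-weaken X⇒Y falsified

  HasFalsified-mono : ∀ {cs cs′ X} → cs ⊆ cs′ → HasFalsified cs ρ X → HasFalsified cs′ ρ X
  HasFalsified-mono cs⊆cs′ (D , D∈ , falsified) = D , cs⊆cs′ D∈ , falsified

  CatchesViolation-mono : ∀ {cs cs′ V p} → cs ⊆ cs′ → CatchesViolation cs V p ρ → CatchesViolation cs′ V p ρ
  CatchesViolation-mono cs⊆cs′ caught = HasFalsified-mono cs⊆cs′ ∘ caught

DerivesParity-mono : ∀ {cs cs′ V p} → cs ⊆ cs′ → DerivesParity cs V p → DerivesParity cs′ V p
DerivesParity-mono cs⊆cs′ derives ρ = CatchesViolation-mono cs⊆cs′ (derives ρ)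

_[_≔_] : Assignment → ℕ → Bool → Assignment
(ρ [ y ≔ b ]) x with x ≟ y
... | yes _ = b
... | no  _ = ρ x

AgreeOn : List ℕ → Assignment → Assignment → Set
AgreeOn V ρ σ = ∀ {x} → x ∈ V → ρ x ≡ σ x

parityOn-cong : ∀ {V ρ σ} → AgreeOn V ρ σ → parityOn ρ V ≡ parityOn σ V
parityOn-cong agree = cong parity (map-cong-local (All.tabulate agree))

FalsifiedWithin-cong : ∀ {V ρ σ D} → AgreeOn V ρ σ → FalsifiedWithin σ D (_∈ V) → FalsifiedWithin ρ D (_∈ V)
FalsifiedWithin-cong agree falsified l∈D with falsified l∈D
... | x , refl , x∈V = x , cong (λ b → x , not b) (sym (agree x∈V)) , x∈V

[≔]-agreeOff : ∀ {V y} ρ b → y ∉ V → AgreeOn V (ρ [ y ≔ b ]) ρ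
[≔]-agreeOff {y = y} ρ b y∉V {x} x∈V with x ≟ y
... | yes refl = contradiction x∈V y∉V
... | no  _    = refl

FalsifiedWithin-unset : ∀ {ρ y b D A} → FalsifiedWithin (ρ [ y ≔ b ]) D (_∈ y ∷ A) →
                        ∀ {l} → l ∈ D → l ≢ (y , not b) → ∃[ x ] l ≡ falseLit ρ x × x ∈ A
FalsifiedWithin-unset {ρ} {y} falsified l∈D l≢ with falsified l∈D
... | x , refl , x∈ with x ≟ y
...   | yes refl = contradiction refl l≢
...   | no  x≢y  with x∈
...     | here x≡y   = contradiction x≡y x≢y
...     | there x∈A  = x , refl , x∈A

bothValues : ℕ → List Assignment → List Assignment
bothValues y []       = []
bothValues y (ρ ∷ ρs) = ρ [ y ≔ false ] ∷ ρ [ y ≔ true ] ∷ bothValues y ρs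

assignments : List ℕ → List Assignment
assignments []      = const false ∷ []
assignments (y ∷ V) = bothValues y (assignments V)

length-assignments : ∀ V → length (assignments V) ≡ 2 ^ length V
length-assignments []      = refl
length-assignments (y ∷ V) = trans (length-bothValues (assignments V)) (cong (2 *_) (length-assignments V))
  where
  length-bothValues : ∀ ρs → length (bothValues y ρs) ≡ 2 * length ρs
  length-bothValues []       = refl
  length-bothValues (ρ ∷ ρs) = trans (cong (2 +_) (length-bothValues ρs)) (sym (*-distribˡ-+ 2 1 (length ρs)))

∈-bothValues : ∀ y b {ρ ρs} → ρ ∈ ρs → ρ [ y ≔ b ] ∈ bothValues y ρs
∈-bothValues y false (here refl) = here refl
∈-bothValues y true  (here refl) = there (here refl)
∈-bothValues y b {ρs = _ ∷ _} (there ρ∈) = there (there (∈-bothValues y b ρ∈))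

assignments-complete : ∀ V ρ → ∃[ σ ] σ ∈ assignments V × AgreeOn V ρ σ
assignments-complete []      ρ = const false , here refl , λ ()
assignments-complete (y ∷ V) ρ with assignments-complete V ρ
... | σ , σ∈ , agree = σ [ y ≔ ρ y ] , ∈-bothValues y (ρ y) σ∈ , agree′
  where
  agree′ : AgreeOn (y ∷ V) ρ (σ [ y ≔ ρ y ])
  agree′ {x} x∈ with x ≟ y | x∈
  ... | yes refl | _          = refl
  ... | no  x≢y  | here x≡y   = contradiction x≡y x≢y
  ... | no  _    | there x∈V  = agree x∈V

DerivesParity-fromAssignments : ∀ {cs V p} → (∀ {σ} → σ ∈ assignments V → CatchesViolation cs V p σ) → DerivesParity cs V p
DerivesParity-fromAssignments {V = V} catches ρ violated with assignments-complete V ρ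
... | σ , σ∈ , agree with catches σ∈ (trans (sym (parityOn-cong agree)) violated)
...   | D , D∈ , falsified = D , D∈ , FalsifiedWithin-cong agree falsified

resolve : ℕ → Clause → Clause → Clause
resolve y C D = deduplicate _≟ₗ_ (filter (¬? ∘ (_≟ₗ (y , true))) C ++ filter (¬? ∘ (_≟ₗ (y , false))) D)

resolve-unique : ∀ y C D → Unique (resolve y C D)
resolve-unique y C D = deduplicate-! _

resolve-resolvent : ∀ {y C D} → (y , true) ∈ C → (y , false) ∈ D → Resolvent y C D (resolve y C D)
resolve-resolvent {y} {C} {D} yC yD = yC , yD , λ l → mk⇔ sides merge
  where
  C′ = filter (¬? ∘ (_≟ₗ (y , true))) C
  sides : ∀ {l} → l ∈ resolve y C D → (l ∈ C × l ≢ (y , true)) ⊎ (l ∈ D × l ≢ (y , false))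
  sides l∈ with ∈-++⁻ C′ (Equivalence.from (deduplicate-∈⇔ _≟ₗ_) l∈)
  ... | inj₁ l∈C′ = inj₁ (∈-filter⁻ (¬? ∘ (_≟ₗ (y , true))) l∈C′)
  ... | inj₂ l∈D′ = inj₂ (∈-filter⁻ (¬? ∘ (_≟ₗ (y , false))) l∈D′)
  merge : ∀ {l} → (l ∈ C × l ≢ (y , true)) ⊎ (l ∈ D × l ≢ (y , false)) → l ∈ resolve y C D
  merge (inj₁ (l∈C , l≢)) =
    Equivalence.to (deduplicate-∈⇔ _≟ₗ_) (∈-++⁺ˡ (∈-filter⁺ (¬? ∘ (_≟ₗ (y , true))) l∈C l≢))
  merge (inj₂ (l∈D , l≢)) =
    Equivalence.to (deduplicate-∈⇔ _≟ₗ_) (∈-++⁺ʳ C′ (∈-filter⁺ (¬? ∘ (_≟ₗ (y , false))) l∈D l≢))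

module NarrowResolution (F : CNF) (w : ℕ) where

  record NarrowDerivation : Set where
    constructor narrowDerivation
    field
      lines      : List Clause
      derivation : Derivation F lines
      narrow     : All (λ C → length C ≤ w) lines

  open NarrowDerivation public

  empty : NarrowDerivation
  empty = narrowDerivation [] [] []

  record Extension (S : NarrowDerivation) (b : ℕ) (Q : List Clause → Set) : Set where
    constructor extension
    field
      extended : NarrowDerivation
      keeps    : lines S ⊆ lines extended
      bounded  : length (lines extended) ≤ length (lines S) + b
      property : Q (lines extended)

  module _ {S : NarrowDerivation} where

    unchanged : ∀ {b Q} → Q (lines S) → Extension S b Q
    unchanged q = extension S id (m≤m+n _ _) q

    Extension-weaken : ∀ {b b′} {Q Q′ : List Clause → Set} → b ≤ b′ → (∀ {cs} → Q cs → Q′ cs) →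
                       Extension S b Q → Extension S b′ Q′
    Extension-weaken b≤b′ Q⇒Q′ (extension S′ keeps bounded q) =
      extension S′ keeps (≤-trans bounded (+-monoʳ-≤ _ b≤b′)) (Q⇒Q′ q)

    andThen : ∀ {b b′} {Q Q′ : List Clause → Set} → Extension S b Q →
              (∀ {S′} → lines S ⊆ lines S′ → Q (lines S′) → Extension S′ b′ Q′) → Extension S (b + b′) Q′
    andThen {b} {b′} (extension S₁ keeps₁ bounded₁ q₁) next with next {S₁} keeps₁ q₁
    ... | extension S₂ keeps₂ bounded₂ q₂ = extension S₂ (keeps₂ ∘ keeps₁) bounded q₂
      where
      open ≤-Reasoning
      bounded : length (lines S₂) ≤ length (lines S) + (b + b′)
      bounded = begin
        length (lines S₂)                  ≤⟨ bounded₂ ⟩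
        length (lines S₁) + b′             ≤⟨ +-monoˡ-≤ b′ bounded₁ ⟩
        length (lines S) + b + b′          ≡⟨ +-assoc (length (lines S)) b b′ ⟩
        length (lines S) + (b + b′)        ∎

    addClause : (E : Clause) → Line F (lines S) E → Unique E → length E ≤ w → Extension S 1 (E ∈_)
    addClause E line E! narrowE =
      extension (narrowDerivation (E ∷ lines S) (derivation S ▹ (line , E!)) (narrowE ∷ narrow S))
                there (≤-reflexive (+-comm 1 _)) (here refl)

  forEach : ∀ {S X b} (Q : X → List Clause → Set) → (∀ x {cs cs′} → cs ⊆ cs′ → Q x cs → Q x cs′) →
            (∀ {S′} → lines S ⊆ lines S′ → (x : X) → Extension S′ b (Q x)) →
            (xs : List X) → Extension S (length xs * b) (λ cs → ∀ {x} → x ∈ xs → Q x cs)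
  forEach Q mono step []       = unchanged (λ ())
  forEach {S} Q mono step (x ∷ xs) =
    andThen (step {S} id x) λ {S₁} S⊆S₁ qx →
      let extension S₂ S₁⊆S₂ bounded qxs = forEach {S₁} Q mono (λ S₁⊆S′ → step (S₁⊆S′ ∘ S⊆S₁)) xs
      in  extension S₂ S₁⊆S₂ bounded λ { (here refl) → mono x S₁⊆S₂ qx ; (there x∈) → qxs x∈ }

  deriveParity : ∀ {S b} V p →
                 (∀ {S′} → lines S ⊆ lines S′ → ∀ ρ → parityOn ρ V ≡ not p →
                   Extension S′ b (λ cs → HasFalsified cs ρ (_∈ V))) →
                 Extension S (2 ^ length V * b) (λ cs → DerivesParity cs V p)
  deriveParity {S} V p refute =
    Extension-weaken (≤-reflexive (cong (_* _) (length-assignments V))) DerivesParity-fromAssignments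
      (forEach (λ σ cs → CatchesViolation cs V p σ) (λ σ → CatchesViolation-mono) step (assignments V))
    where
    step : ∀ {S′} → lines S ⊆ lines S′ → ∀ σ → Extension S′ _ (λ cs → CatchesViolation cs V p σ)
    step S⊆S′ σ with parityOn σ V ≟ᵇ not p
    ... | yes violated = Extension-weaken ≤-refl const (refute S⊆S′ σ violated)
    ... | no  holds    = unchanged (λ violated → contradiction violated holds)

  deriveAxioms : ∀ {S} V p → (∀ ρ → parityOn ρ V ≡ not p → map (falseLit ρ) V ∈ F) → length V ≤ w →
                 Extension S (2 ^ length V * 1) (λ cs → DerivesParity cs V p)
  deriveAxioms V p inF V≤w = deriveParity V p λ {S′} _ ρ violated →
    let A = map (falseLit ρ) V
        E = deduplicate _≟ₗ_ A
        E-falsified : FalsifiedWithin ρ E (_∈ V)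
        E-falsified = map-falseLit-falsified V ∘ Equivalence.from (deduplicate-∈⇔ _≟ₗ_)
    in  Extension-weaken ≤-refl (λ E∈ → E , E∈ , E-falsified)
          (addClause {S′} E (axiom A (inF ρ violated) (λ _ → ⇔-sym (deduplicate-∈⇔ _≟ₗ_)))
                     (deduplicate-! A) (≤-trans (FalsifiedWithin-length (deduplicate-! A) E-falsified) V≤w))

  resolveOn : ∀ {S ρ} y A → length A ≤ w →
              HasFalsified (lines S) (ρ [ y ≔ false ]) (_∈ y ∷ A) →
              HasFalsified (lines S) (ρ [ y ≔ true ])  (_∈ y ∷ A) →
              Extension S 1 (λ cs → HasFalsified cs ρ (_∈ A))
  resolveOn {S} {ρ} y A A≤w (D₀ , D₀∈ , falsified₀) (D₁ , D₁∈ , falsified₁)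
    with (y , true) ∈ₗ? D₀ | (y , false) ∈ₗ? D₁
  ... | no y⁺∉D₀  | _        = unchanged (D₀ , D₀∈ , λ l∈ → FalsifiedWithin-unset falsified₀ l∈ λ { refl → y⁺∉D₀ l∈ })
  ... | yes _     | no y⁻∉D₁ = unchanged (D₁ , D₁∈ , λ l∈ → FalsifiedWithin-unset falsified₁ l∈ λ { refl → y⁻∉D₁ l∈ })
  ... | yes y⁺∈D₀ | yes y⁻∈D₁ = Extension-weaken ≤-refl (λ E∈ → E , E∈ , E-falsified)
        (addClause E (res y D₀ D₁ D₀∈ D₁∈ (resolve-resolvent y⁺∈D₀ y⁻∈D₁)) (resolve-unique y D₀ D₁)
                     (≤-trans (FalsifiedWithin-length (resolve-unique y D₀ D₁) E-falsified) A≤w))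
    where
    E = resolve y D₀ D₁
    E-falsified : FalsifiedWithin ρ E (_∈ A)
    E-falsified l∈ with Equivalence.to (proj₂ (proj₂ (resolve-resolvent y⁺∈D₀ y⁻∈D₁)) _) l∈
    ... | inj₁ (l∈D₀ , l≢) = FalsifiedWithin-unset falsified₀ l∈D₀ l≢
    ... | inj₂ (l∈D₁ , l≢) = FalsifiedWithin-unset falsified₁ l∈D₁ l≢

  module _ {V₁ V₂ V₃ : List ℕ} {p₁ p₂ : Bool}
           (parity-sum : ∀ ρ → parityOn ρ V₁ xor parityOn ρ V₂ ≡ parityOn ρ V₃) where

    -- A decision tree on the variables U that are eliminated from V₁ ∪ V₂; A holds V₃ and the variables
    -- branched on so far, so every resolvent has width at most length A ≤ w.
    refuteByBranching : ∀ {S} U A → All (_∉ V₃) U → (∀ {x} → x ∈ V₁ ⊎ x ∈ V₂ → x ∈ A ⊎ x ∈ U) →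
                        length A + length U ≤ suc w →
                        DerivesParity (lines S) V₁ p₁ → DerivesParity (lines S) V₂ p₂ →
                        ∀ ρ → parityOn ρ V₃ ≡ not (p₁ xor p₂) →
                        Extension S (3 ^ length U) (λ cs → HasFalsified cs ρ (_∈ A))
    refuteByBranching [] A _ covered _ derives₁ derives₂ ρ violated
      with xor-violation _ _ p₁ p₂ (trans (parity-sum ρ) violated)
    ... | inj₁ violated₁ = unchanged (HasFalsified-weaken ([ id , (λ ()) ] ∘ covered ∘ inj₁) (derives₁ ρ violated₁))
    ... | inj₂ violated₂ = unchanged (HasFalsified-weaken ([ id , (λ ()) ] ∘ covered ∘ inj₂) (derives₂ ρ violated₂))
    refuteByBranching (y ∷ U) A (y∉V₃ ∷ U∉V₃) covered narrowAU derives₁ derives₂ ρ violated =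
      Extension-weaken (branchingCost (length U)) id
        (andThen (branch false derives₁ derives₂) λ S⊆S₀ falsified₀ →
         andThen (branch true (DerivesParity-mono S⊆S₀ derives₁) (DerivesParity-mono S⊆S₀ derives₂))
           λ S₀⊆S₁ falsified₁ →
         resolveOn y A narrowA (HasFalsified-mono S₀⊆S₁ falsified₀) falsified₁)
      where
      narrowA : length A ≤ w
      narrowA = ≤-pred (≤-trans (s≤s (m≤m+n _ _)) (≤-trans (≤-reflexive (sym (+-suc _ _))) narrowAU))
      covered′ : ∀ {x} → x ∈ V₁ ⊎ x ∈ V₂ → x ∈ y ∷ A ⊎ x ∈ U
      covered′ x∈ with covered x∈
      ... | inj₁ x∈A             = inj₁ (there x∈A)
      ... | inj₂ (here refl)     = inj₁ (here refl)
      ... | inj₂ (there x∈U)     = inj₂ x∈U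
      branch : ∀ b {S′} → DerivesParity (lines S′) V₁ p₁ → DerivesParity (lines S′) V₂ p₂ →
               Extension S′ (3 ^ length U) (λ cs → HasFalsified cs (ρ [ y ≔ b ]) (_∈ y ∷ A))
      branch b derives₁′ derives₂′ =
        refuteByBranching U (y ∷ A) U∉V₃ covered′ (≤-trans (≤-reflexive (sym (+-suc _ _))) narrowAU)
          derives₁′ derives₂′ (ρ [ y ≔ b ]) (trans (parityOn-cong ([≔]-agreeOff ρ b y∉V₃)) violated)
      branchingCost : ∀ u → 3 ^ u + (3 ^ u + 1) ≤ 3 ^ suc u
      branchingCost u = +-monoʳ-≤ (3 ^ u) (+-monoʳ-≤ (3 ^ u) (≤-trans (m^n>0 3 u) (≤-reflexive (sym (+-identityʳ _)))))

    deriveSum : ∀ {S} U → All (_∉ V₃) U → (∀ {x} → x ∈ V₁ ⊎ x ∈ V₂ → x ∈ V₃ ⊎ x ∈ U) →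
                length V₃ + length U ≤ suc w →
                DerivesParity (lines S) V₁ p₁ → DerivesParity (lines S) V₂ p₂ →
                Extension S (2 ^ length V₃ * 3 ^ length U) (λ cs → DerivesParity cs V₃ (p₁ xor p₂))
    deriveSum U U∉V₃ covered narrowV₃U derives₁ derives₂ = deriveParity V₃ (p₁ xor p₂) λ S⊆S′ →
      refuteByBranching U V₃ U∉V₃ covered narrowV₃U
        (DerivesParity-mono S⊆S′ derives₁) (DerivesParity-mono S⊆S′ derives₂)

≤ᵇ-true : ∀ {m n} → m ≤ n → (m ≤ᵇ n) ≡ true
≤ᵇ-true = Equivalence.to T-≡ ∘ ≤⇒≤ᵇ

≤ᵇ-false : ∀ {m n} → n < m → (m ≤ᵇ n) ≡ false
≤ᵇ-false {m} {n} n<m = ¬-not (<⇒≱ n<m ∘ ≤ᵇ⇒≤ m n ∘ Equivalence.from T-≡)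

≡ᵇ-true : ∀ {m n} → m ≡ n → (m ≡ᵇ n) ≡ true
≡ᵇ-true {m} {n} m≡n = Equivalence.to T-≡ (≡⇒≡ᵇ m n m≡n)

≡ᵇ-false : ∀ {m n} → m ≢ n → (m ≡ᵇ n) ≡ false
≡ᵇ-false {m} {n} m≢n = ¬-not (m≢n ∘ ≡ᵇ⇒≡ m n ∘ Equivalence.from T-≡)

<ᵇ-suc : ∀ i t → (i <ᵇ suc t) ≡ (i <ᵇ t) xor (i ≡ᵇ t)
<ᵇ-suc zero    zero    = refl
<ᵇ-suc zero    (suc t) = refl
<ᵇ-suc (suc i) zero    = refl
<ᵇ-suc (suc i) (suc t) = <ᵇ-suc i t

≤ᵇ-suc : ∀ i t → (i ≤ᵇ suc t) ≡ (i ≤ᵇ t) xor (i ≡ᵇ suc t)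
≤ᵇ-suc zero    t = refl
≤ᵇ-suc (suc i) t = <ᵇ-suc i t

≤∸1⇒< : ∀ {a n} → 1 ≤ a → a ≤ n ∸ 1 → a < n
≤∸1⇒< {suc a} {suc n} _ a≤n = s≤s a≤n

∈-filterᵇ⁻ : ∀ {A : Set} {p : A → Bool} {xs x} → x ∈ filterᵇ p xs → x ∈ xs × T (p x)
∈-filterᵇ⁻ {p = p} = ∈-filter⁻ (T? ∘ p)

∈-filterᵇ⁺ : ∀ {A : Set} {p : A → Bool} {xs x} → x ∈ xs → T (p x) → x ∈ filterᵇ p xs
∈-filterᵇ⁺ {p = p} = ∈-filter⁺ (T? ∘ p)

∨≡xor : ∀ x y → (x ∧ y) ≡ false → x ∨ y ≡ x xor y
∨≡xor true  true  ()
∨≡xor true  false _ = refl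
∨≡xor false y     _ = refl

≡ᵇ-sym : ∀ m n → (m ≡ᵇ n) ≡ (n ≡ᵇ m)
≡ᵇ-sym zero    zero    = refl
≡ᵇ-sym zero    (suc n) = refl
≡ᵇ-sym (suc m) zero    = refl
≡ᵇ-sym (suc m) (suc n) = ≡ᵇ-sym m n

∈-range1⁺ : ∀ {n a} → 1 ≤ a → a ≤ n → a ∈ range1 n
∈-range1⁺ {a = suc a} _ a≤n = ∈-map⁺ suc (∈-upTo⁺ a≤n)

∈-range1⁻ : ∀ {n a} → a ∈ range1 n → 1 ≤ a × a ≤ n
∈-range1⁻ a∈ with ∈-map⁻ suc a∈
... | b , b∈ , refl = s≤s z≤n , ∈-upTo⁻ b∈

Unique-range1 : ∀ n → Unique (range1 n)
Unique-range1 n = Unique.map⁺ suc-injective (Unique.upTo⁺ n)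

length-range1 : ∀ n → length (range1 n) ≡ n
length-range1 n = trans (length-map suc (upTo n)) (length-upTo n)

allBools-complete : ∀ α → α ∈ allBools (length α)
allBools-complete []      = here refl
allBools-complete (b ∷ α) =
  ∈-concatMap⁺ (λ bs → (false ∷ bs) ∷ (true ∷ bs) ∷ []) (Any.map (λ { refl → bothHeads b }) (allBools-complete α))
  where
  bothHeads : ∀ b → (b ∷ α) ∈ (false ∷ α) ∷ (true ∷ α) ∷ []
  bothHeads false = here refl
  bothHeads true  = there (here refl)

vertexCost : ℕ → ℕ
vertexCost k = 272 * 2 ^ k

vertexCost-bound : ∀ k {a b s} → a ≤ 4 → b + s ≤ k + 4 → s ≤ 4 → 2 ^ a * 1 + 2 ^ b * 3 ^ s ≤ vertexCost k
vertexCost-bound k {a} {b} {s} a≤4 b+s≤k+4 s≤4 = begin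
  2 ^ a * 1 + 2 ^ b * 3 ^ s  ≤⟨ +-mono-≤ (*-mono-≤ (^-monoʳ-≤ 2 a≤4) (m^n>0 2 k)) resolutionCost ⟩
  16 * 2 ^ k + 256 * 2 ^ k   ≡⟨ *-distribʳ-+ (2 ^ k) 16 256 ⟨
  272 * 2 ^ k                ∎
  where
  open ≤-Reasoning
  exponent-bound : b + 2 * s ≤ 8 + k
  exponent-bound = begin
    b + 2 * s  ≡⟨ solve 2 (λ b s → b :+ con 2 :* s := b :+ s :+ s) refl b s ⟩
    b + s + s  ≤⟨ +-mono-≤ b+s≤k+4 s≤4 ⟩
    k + 4 + 4  ≡⟨ solve 1 (λ k → k :+ con 4 :+ con 4 := con 8 :+ k) refl k ⟩
    8 + k      ∎
  resolutionCost : 2 ^ b * 3 ^ s ≤ 256 * 2 ^ k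
  resolutionCost = begin
    2 ^ b * 3 ^ s        ≤⟨ *-monoʳ-≤ (2 ^ b) (^-monoˡ-≤ s (n≤1+n 3)) ⟩
    2 ^ b * 4 ^ s        ≡⟨ cong (2 ^ b *_) (^-*-assoc 2 2 s) ⟩
    2 ^ b * 2 ^ (2 * s)  ≡⟨ ^-distribˡ-+-* 2 b (2 * s) ⟨
    2 ^ (b + 2 * s)      ≤⟨ ^-monoʳ-≤ 2 exponent-bound ⟩
    2 ^ (8 + k)          ≡⟨ ^-distribˡ-+-* 2 8 k ⟩
    256 * 2 ^ k          ∎

filterᵇ-cong-local : ∀ {A : Set} {p q : A → Bool} xs → (∀ {x} → x ∈ xs → p x ≡ q x) → filterᵇ p xs ≡ filterᵇ q xs
filterᵇ-cong-local []       _   = refl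
filterᵇ-cong-local {p = p} {q} (x ∷ xs) p≡q with p x | q x | p≡q (here refl)
... | true  | true  | _ = cong (x ∷_) (filterᵇ-cong-local xs (p≡q ∘ there))
... | false | false | _ = filterᵇ-cong-local xs (p≡q ∘ there)

grid : ∀ {A : Set} → (ℕ → ℕ → A) → ℕ → ℕ → List A
grid g n m = concatMap (λ i → map (g i) (range1 m)) (range1 n)

grid≡cartesianProductWith : ∀ {A : Set} (g : ℕ → ℕ → A) n m → grid g n m ≡ cartesianProductWith g (range1 n) (range1 m)
grid≡cartesianProductWith g n m = go (range1 n)
  where
  go : ∀ is → concatMap (λ i → map (g i) (range1 m)) is ≡ cartesianProductWith g is (range1 m)
  go []       = refl
  go (i ∷ is) = cong (map (g i) (range1 m) ++_) (go is)

∈-grid⁺ : ∀ {A : Set} (g : ℕ → ℕ → A) {n m i a} → 1 ≤ i → i ≤ n → 1 ≤ a → a ≤ m → g i a ∈ grid g n m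
∈-grid⁺ g {n} {m} 1≤i i≤n 1≤a a≤m rewrite grid≡cartesianProductWith g n m =
  ∈-cartesianProductWith⁺ g (∈-range1⁺ 1≤i i≤n) (∈-range1⁺ 1≤a a≤m)

∈-grid⁻ : ∀ {A : Set} (g : ℕ → ℕ → A) {n m x} → x ∈ grid g n m →
          ∃₂ λ i a → (1 ≤ i × i ≤ n) × (1 ≤ a × a ≤ m) × x ≡ g i a
∈-grid⁻ g {n} {m} x∈ rewrite grid≡cartesianProductWith g n m with ∈-cartesianProductWith⁻ g (range1 n) (range1 m) x∈
... | i , a , i∈ , a∈ , x≡ = i , a , ∈-range1⁻ i∈ , ∈-range1⁻ a∈ , x≡

Unique-grid : ∀ {A : Set} (g : ℕ → ℕ → A) n m → (∀ {i i′ a a′} → g i a ≡ g i′ a′ → i ≡ i′ × a ≡ a′) →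
              Unique (grid g n m)
Unique-grid g n m g-injective rewrite grid≡cartesianProductWith g n m =
  Unique.cartesianProductWith⁺ g g-injective (Unique-range1 n) (Unique-range1 m)

module Cylinder (k c : ℕ) (P : ℕ → ℕ) (2≤k : 2 ≤ k) where

  open Cyl k c P

  hEdge vEdge : ℕ → ℕ → Edge
  hEdge i a = (i , a) , (i , suc a)
  vEdge i a = (i , a) , (suc i , a)

  wEdge : ℕ → Edge
  wEdge a = (k , a) , (1 , a)

  horizontals verticals wraps : List Edge
  horizontals = grid hEdge k (N ∸ 1)
  verticals   = grid vEdge (k ∸ 1) N
  wraps       = if 2 <ᵇ k then map wEdge (range1 N) else []

  data Shape : Edge → Set where
    horizontal : ∀ {i a} → 1 ≤ i → i ≤ k → 1 ≤ a → a < N → Shape (hEdge i a)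
    vertical   : ∀ {i a} → 1 ≤ i → i < k → 1 ≤ a → a ≤ N → Shape (vEdge i a)
    wrap       : ∀ {a} → 2 < k → 1 ≤ a → a ≤ N → Shape (wEdge a)

  ∈-wraps⁻ : ∀ {e} → e ∈ wraps → ∃[ a ] (2 < k × 1 ≤ a × a ≤ N) × e ≡ wEdge a
  ∈-wraps⁻ e∈ with 2 <ᵇ k in 2<ᵇk
  ... | true with ∈-map⁻ wEdge e∈
  ...   | a , a∈ , e≡ = a , (<ᵇ⇒< 2 k (Equivalence.from T-≡ 2<ᵇk) , ∈-range1⁻ a∈) , e≡

  shape : ∀ {e} → e ∈ edges → Shape e
  shape e∈ with ∈-++⁻ horizontals e∈
  ... | inj₁ e∈H with ∈-grid⁻ hEdge {k} {N ∸ 1} e∈H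
  ...   | i , a , (1≤i , i≤k) , (1≤a , a≤N∸1) , refl = horizontal 1≤i i≤k 1≤a (≤∸1⇒< 1≤a a≤N∸1)
  shape e∈ | inj₂ e∈VW with ∈-++⁻ verticals e∈VW
  ... | inj₁ e∈V with ∈-grid⁻ vEdge {k ∸ 1} {N} e∈V
  ...   | i , a , (1≤i , i≤k∸1) , (1≤a , a≤N) , refl = vertical 1≤i (≤∸1⇒< 1≤i i≤k∸1) 1≤a a≤N
  shape e∈ | inj₂ e∈VW | inj₂ e∈W with ∈-wraps⁻ e∈W
  ... | a , (2<k , 1≤a , a≤N) , refl = wrap 2<k 1≤a a≤N

  edges-unique : Unique edges
  edges-unique = Unique.++⁺ (Unique-grid hEdge k (N ∸ 1) λ { refl → refl , refl })
                   (Unique.++⁺ (Unique-grid vEdge (k ∸ 1) N λ { refl → refl , refl }) wraps-unique verticals∩wraps)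
                   horizontals∩others
    where
    wraps-unique : Unique wraps
    wraps-unique with 2 <ᵇ k
    ... | true  = Unique.map⁺ (λ { refl → refl }) (Unique-range1 N)
    ... | false = []
    verticals∩wraps : Disjoint verticals wraps
    verticals∩wraps (e∈V , e∈W) with ∈-grid⁻ vEdge {k ∸ 1} {N} e∈V | ∈-wraps⁻ e∈W
    ... | i , a , (1≤i , i≤k∸1) , _ , refl | _ , _ , e≡ =
      <-irrefl (cong (proj₁ ∘ proj₁) e≡) (≤∸1⇒< 1≤i i≤k∸1)
    horizontals∩others : Disjoint horizontals (verticals ++ wraps)
    horizontals∩others (e∈H , e∈VW) with ∈-grid⁻ hEdge {k} {N ∸ 1} e∈H | ∈-++⁻ verticals e∈VW
    ... | _ , _ , _ , _ , refl | inj₁ e∈V with ∈-grid⁻ vEdge {k ∸ 1} {N} e∈V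
    ...   | _ , _ , _ , _ , ()
    horizontals∩others (e∈H , e∈VW) | _ , _ , _ , _ , refl | inj₂ e∈W with ∈-wraps⁻ e∈W
    ...   | _ , _ , ()

  swept : ℕ → ℕ → Vertex → Bool
  swept j t (i , a) = (a ≤ᵇ j) ∨ ((a ≡ᵇ suc j) ∧ (i ≤ᵇ t))

  crosses : ℕ → ℕ → Edge → Bool
  crosses j t (u , v) = swept j t u xor swept j t v

  swept-before : ∀ {j t i a} → a ≤ j → swept j t (i , a) ≡ true
  swept-before a≤j rewrite ≤ᵇ-true a≤j = refl

  swept-current : ∀ j t i → swept j t (i , suc j) ≡ (i ≤ᵇ t)
  swept-current j t i rewrite ≤ᵇ-false (n<1+n j) | ≡ᵇ-true {j} refl = refl

  swept-after : ∀ {j t i a} → suc j < a → swept j t (i , a) ≡ false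
  swept-after {j} {t} {i} {a} j+1<a rewrite ≤ᵇ-false (<-trans (n<1+n j) j+1<a) | ≡ᵇ-false (>⇒≢ j+1<a) = refl

  swept-step : ∀ j t v → swept j (suc t) v ≡ swept j t v xor isV v (suc t , suc j)
  swept-step j t (i , a) with <-cmp a (suc j)
  ... | tri< (s≤s a≤j) a≢ _ rewrite swept-before {j} {suc t} {i} a≤j | swept-before {j} {t} {i} a≤j
                                   | ≡ᵇ-false a≢ | ∧-zeroʳ (i ≡ᵇ suc t) = refl
  ... | tri≈ _ refl _ rewrite swept-current j (suc t) i | swept-current j t i
                             | ≡ᵇ-true {j} refl | ∧-identityʳ (i ≡ᵇ suc t) = ≤ᵇ-suc i t
  ... | tri> _ a≢ j+1<a rewrite swept-after {j} {suc t} {i} j+1<a | swept-after {j} {t} {i} j+1<a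
                               | ≡ᵇ-false a≢ | ∧-zeroʳ (i ≡ᵇ suc t) = refl

  swept-nextColumn : ∀ j {i a} → 1 ≤ i → i ≤ k → swept j k (i , a) ≡ swept (suc j) 0 (i , a)
  swept-nextColumn j {suc i} {a} _ i≤k rewrite ∧-zeroʳ (a ≡ᵇ suc (suc j)) with <-cmp a (suc j)
  ... | tri< (s≤s a≤j) _ _ rewrite swept-before {j} {k} {suc i} a≤j | ≤ᵇ-true (m≤n⇒m≤1+n a≤j) = refl
  ... | tri≈ _ refl _     rewrite swept-current j k (suc i) | ≤ᵇ-true i≤k | ≤ᵇ-true (≤-refl {suc j}) = refl
  ... | tri> _ _ j+1<a    rewrite swept-after {j} {k} {suc i} j+1<a | ≤ᵇ-false j+1<a = refl

  swept-start : ∀ {i a} → 1 ≤ i → 1 ≤ a → swept 0 0 (i , a) ≡ false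
  swept-start {suc i} {suc zero}    _ _ = refl
  swept-start {suc i} {suc (suc a)} _ _ = refl

  InGrid : Vertex → Set
  InGrid (i , a) = (1 ≤ i × i ≤ k) × (1 ≤ a × a ≤ N)

  shape-inGrid : ∀ {u v} → Shape (u , v) → InGrid u × InGrid v
  shape-inGrid (horizontal 1≤i i≤k 1≤a a<N) = ((1≤i , i≤k) , (1≤a , <⇒≤ a<N)) , ((1≤i , i≤k) , (s≤s z≤n , a<N))
  shape-inGrid (vertical 1≤i i<k 1≤a a≤N)   = ((1≤i , <⇒≤ i<k) , (1≤a , a≤N)) , ((s≤s z≤n , i<k) , (1≤a , a≤N))
  shape-inGrid (wrap _ 1≤a a≤N)             = ((1≤k , ≤-refl) , (1≤a , a≤N)) , ((≤-refl , 1≤k) , (1≤a , a≤N))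
    where 1≤k = <⇒≤ 2≤k

  shape-proper : ∀ {u v} → Shape (u , v) → u ≢ v
  shape-proper (horizontal _ _ _ _) ()
  shape-proper (vertical _ _ _ _)   ()
  shape-proper (wrap _ _ _) u≡v     = <-irrefl (sym (cong proj₁ u≡v)) 2≤k

  isV-sound : ∀ u v → T (isV u v) → u ≡ v
  isV-sound (i , a) (j , b) u≈v with Equivalence.to T-∧ u≈v
  ... | i≈j , a≈b = cong₂ _,_ (≡ᵇ⇒≡ i j i≈j) (≡ᵇ⇒≡ a b a≈b)

  isV-sym : ∀ u v → isV u v ≡ isV v u
  isV-sym (i , a) (j , b) = cong₂ _∧_ (≡ᵇ-sym i j) (≡ᵇ-sym a b)

  isV-exclusive : ∀ {u v} w → u ≢ v → (isV u w ∧ isV v w) ≡ false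
  isV-exclusive {u} {v} w u≢v = ¬-not λ both →
    let u≈w , v≈w = Equivalence.to T-∧ (Equivalence.from T-≡ both)
    in  u≢v (trans (isV-sound u w u≈w) (sym (isV-sound v w v≈w)))

  incidentTo : Vertex → Edge → Bool
  incidentTo v e = isV (proj₁ e) v ∨ isV (proj₂ e) v

  crosses-step : ∀ j t {e} → e ∈ edges → crosses j (suc t) e ≡ crosses j t e xor incidentTo (suc t , suc j) e
  crosses-step j t {u , v} e∈ rewrite swept-step j t u | swept-step j t v =
    trans (xor-interchange (swept j t u) _ (swept j t v) _) (cong (crosses j t (u , v) xor_) (sym ∨≡xor-at))
    where
    ∨≡xor-at = ∨≡xor (isV u (suc t , suc j)) (isV v (suc t , suc j))
                     (isV-exclusive (suc t , suc j) (shape-proper (shape e∈)))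

  crosses-nextColumn : ∀ j {e} → e ∈ edges → crosses j k e ≡ crosses (suc j) 0 e
  crosses-nextColumn j {(i , a) , (i′ , a′)} e∈ with shape-inGrid (shape e∈)
  ... | ((1≤i , i≤k) , _) , ((1≤i′ , i′≤k) , _) =
    cong₂ _xor_ (swept-nextColumn j {i} {a} 1≤i i≤k) (swept-nextColumn j {i′} {a′} 1≤i′ i′≤k)

  crosses-start : ∀ {e} → e ∈ edges → crosses 0 0 e ≡ false
  crosses-start {(i , a) , (i′ , a′)} e∈ with shape-inGrid (shape e∈)
  ... | ((1≤i , _) , (1≤a , _)) , ((1≤i′ , _) , (1≤a′ , _)) =
    cong₂ _xor_ (swept-start {i} {a} 1≤i 1≤a) (swept-start {i′} {a′} 1≤i′ 1≤a′)

  crosses-end : ∀ {e} → e ∈ edges → crosses N 0 e ≡ false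
  crosses-end {(i , a) , (i′ , a′)} e∈ with shape-inGrid (shape e∈)
  ... | (_ , (_ , a≤N)) , (_ , (_ , a′≤N)) =
    cong₂ _xor_ (swept-before {N} {0} {i} a≤N) (swept-before {N} {0} {i′} a′≤N)

  crosses-horizontal : ∀ {j t i a} → T (crosses j t (hEdge i a)) → a ≡ (if i ≤ᵇ t then suc j else j)
  crosses-horizontal {j} {t} {i} {a} cr with <-cmp a (suc j)
  ... | tri< (s≤s a≤j) _ _ with <-cmp (suc a) (suc j)
  ...   | tri< (s≤s a+1≤j) _ _ rewrite swept-before {j} {t} {i} a≤j | swept-before {j} {t} {i} a+1≤j = ⊥-elim cr
  ...   | tri≈ _ refl _ rewrite swept-before {j} {t} {i} a≤j | swept-current j t i with i ≤ᵇ t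
  ...     | true  = ⊥-elim cr
  ...     | false = refl
  crosses-horizontal {j} {t} {i} {a} cr | tri< (s≤s a≤j) _ _ | tri> _ _ j<a = contradiction (s≤s a≤j) (<⇒≱ j<a)
  crosses-horizontal {j} {t} {i} cr | tri≈ _ refl _
    rewrite swept-current j t i | swept-after {j} {t} {i} (≤-refl {suc (suc j)}) with i ≤ᵇ t
  ... | true  = refl
  ... | false = ⊥-elim cr
  crosses-horizontal {j} {t} {i} {a} cr | tri> _ _ j+1<a
    rewrite swept-after {j} {t} {i} j+1<a | swept-after {j} {t} {i} (m<n⇒m<1+n j+1<a) = ⊥-elim cr

  crosses-vertical : ∀ {j t i a} → T (crosses j t (vEdge i a)) → i ≡ t × a ≡ suc j
  crosses-vertical {j} {t} {i} {a} cr with <-cmp a (suc j)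
  ... | tri< (s≤s a≤j) _ _ rewrite swept-before {j} {t} {i} a≤j | swept-before {j} {t} {suc i} a≤j = ⊥-elim cr
  ... | tri> _ _ j+1<a rewrite swept-after {j} {t} {i} j+1<a | swept-after {j} {t} {suc i} j+1<a = ⊥-elim cr
  ... | tri≈ _ refl _ rewrite swept-current j t i | swept-current j t (suc i) with <-cmp i t
  ...   | tri< i<t _ _ rewrite ≤ᵇ-true (<⇒≤ i<t) | ≤ᵇ-true i<t = ⊥-elim cr
  ...   | tri≈ _ refl _ = refl , refl
  ...   | tri> _ _ t<i rewrite ≤ᵇ-false t<i | ≤ᵇ-false (m<n⇒m<1+n t<i) = ⊥-elim cr

  crosses-wrap : ∀ {j t a} → T (crosses j t (wEdge a)) → t ≢ k × a ≡ suc j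
  crosses-wrap {j} {t} {a} cr with <-cmp a (suc j)
  ... | tri< (s≤s a≤j) _ _ rewrite swept-before {j} {t} {k} a≤j | swept-before {j} {t} {1} a≤j = ⊥-elim cr
  ... | tri> _ _ j+1<a rewrite swept-after {j} {t} {k} j+1<a | swept-after {j} {t} {1} j+1<a = ⊥-elim cr
  ... | tri≈ _ refl _ rewrite swept-current j t k | swept-current j t 1 with t ≟ k
  ...   | yes refl rewrite ≤ᵇ-true (≤-refl {k}) | ≤ᵇ-true (<⇒≤ 2≤k) = ⊥-elim cr
  ...   | no t≢k = t≢k , refl

  cutCandidates : ℕ → ℕ → List Edge
  cutCandidates j t = map (λ i → hEdge i (if i ≤ᵇ t then suc j else j)) (range1 k)
                      ++ (if t ≡ᵇ k then [] else vEdge t (suc j) ∷ wEdge (suc j) ∷ [])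

  crossing⊆cutCandidates : ∀ {j t e} → e ∈ edges → T (crosses j t e) → e ∈ cutCandidates j t
  crossing⊆cutCandidates {j} {t} e∈ cr with shape e∈
  ... | horizontal {i} {a} 1≤i i≤k _ _ with crosses-horizontal {j} {t} {i} {a} cr
  ...   | refl = ∈-++⁺ˡ (∈-map⁺ (λ i → hEdge i (if i ≤ᵇ t then suc j else j)) (∈-range1⁺ 1≤i i≤k))
  crossing⊆cutCandidates {j} {t} e∈ cr | vertical {i} {a} _ i<k _ _ with crosses-vertical {j} {t} {i} {a} cr
  ...   | refl , refl rewrite ≡ᵇ-false (<⇒≢ i<k) = ∈-++⁺ʳ _ (here refl)
  crossing⊆cutCandidates {j} {t} e∈ cr | wrap {a} _ _ _ with crosses-wrap {j} {t} {a} cr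
  ...   | t≢k , refl rewrite ≡ᵇ-false t≢k = ∈-++⁺ʳ _ (there (here refl))

  -- Candidate lists over-approximate; they may contain non-edges, such as upEdge j 0 when k = 2.
  upEdge : ℕ → ℕ → Edge
  upEdge j zero    = wEdge (suc j)
  upEdge j (suc t) = vEdge (suc t) (suc j)

  downEdge : ℕ → ℕ → Edge
  downEdge j t = if suc t ≡ᵇ k then wEdge (suc j) else vEdge (suc t) (suc j)

  incidentCandidates : ℕ → ℕ → List Edge
  incidentCandidates j t = hEdge (suc t) j ∷ hEdge (suc t) (suc j) ∷ upEdge j t ∷ downEdge j t ∷ []

  closedCandidates : ℕ → ℕ → List Edge
  closedCandidates j t = hEdge (suc t) j ∷ upEdge j t ∷ (if suc t ≡ᵇ k then wEdge (suc j) ∷ [] else [])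

  incidentTo-sound : ∀ v e → T (incidentTo v e) → proj₁ e ≡ v ⊎ proj₂ e ≡ v
  incidentTo-sound v (u , w) incident with Equivalence.to T-∨ incident
  ... | inj₁ u≈v = inj₁ (isV-sound u v u≈v)
  ... | inj₂ w≈v = inj₂ (isV-sound w v w≈v)

  incident⊆candidates : ∀ {j t e} → e ∈ edges → T (incidentTo (suc t , suc j) e) → e ∈ incidentCandidates j t
  incident⊆candidates {j} {t} {e} e∈ incident with shape e∈ | incidentTo-sound (suc t , suc j) e incident
  ... | horizontal _ _ _ _       | inj₁ refl = there (here refl)
  ... | horizontal _ _ _ _       | inj₂ refl = here refl
  ... | vertical _ i<k _ _       | inj₁ refl rewrite ≡ᵇ-false (<⇒≢ i<k) = there (there (there (here refl)))
  ... | vertical (s≤s z≤n) _ _ _ | inj₂ refl = there (there (here refl))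
  ... | wrap _ _ _               | inj₁ k,a≡v
    rewrite cong proj₂ k,a≡v | ≡ᵇ-true (sym (cong proj₁ k,a≡v)) = there (there (there (here refl)))
  ... | wrap _ _ _               | inj₂ refl = there (there (here refl))

  rightEdge-crosses : ∀ j t → T (crosses j t (hEdge t (suc j)))
  rightEdge-crosses j t
    rewrite swept-current j t t | swept-after {j} {t} {t} (≤-refl {suc (suc j)}) | ≤ᵇ-true (≤-refl {t}) = _

  downEdge-crosses : ∀ j t → T (crosses j t (vEdge t (suc j)))
  downEdge-crosses j t
    rewrite swept-current j t t | swept-current j t (suc t) | ≤ᵇ-true (≤-refl {t}) | ≤ᵇ-false (n<1+n t) = _

  closed⊆candidates : ∀ {j t e} → e ∈ edges → T (incidentTo (suc t , suc j) e) → ¬ T (crosses j (suc t) e) →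
                      e ∈ closedCandidates j t
  closed⊆candidates {j} {t} e∈ incident uncut with incident⊆candidates e∈ incident
  ... | here refl                         = here refl
  ... | there (here refl)                 = contradiction (rightEdge-crosses j (suc t)) uncut
  ... | there (there (here refl))         = there (here refl)
  ... | there (there (there (here refl))) with suc t ≡ᵇ k
  ...   | true  = there (there (here refl))
  ...   | false = contradiction (downEdge-crosses j (suc t)) uncut

  length-window : ∀ j t → length (cutCandidates j (suc t) ++ closedCandidates j t) ≤ k + 4
  length-window j t
    rewrite length-++ (cutCandidates j (suc t)) {closedCandidates j t}
          | length-++ (map (λ i → hEdge i (if i ≤ᵇ suc t then suc j else j)) (range1 k))
                      {if suc t ≡ᵇ k then [] else vEdge (suc t) (suc j) ∷ wEdge (suc j) ∷ []}
          | length-map (λ i → hEdge i (if i ≤ᵇ suc t then suc j else j)) (range1 k)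
          | length-range1 k
    with suc t ≡ᵇ k
  ... | true  = ≤-trans (≤-reflexive (+-assoc k 0 3)) (+-monoʳ-≤ k (n≤1+n 3))
  ... | false = ≤-reflexive (+-assoc k 2 2)

  vertex∈vertices : ∀ {i a} → 1 ≤ i → i ≤ k → 1 ≤ a → a ≤ N → (i , a) ∈ vertices
  vertex∈vertices = ∈-grid⁺ _,_

  incident-unique : ∀ v → Unique (incident v)
  incident-unique v = Unique.filter⁺ (T? ∘ incidentTo v) edges-unique

  length-incident : ∀ j t → length (incident (suc t , suc j)) ≤ 4
  length-incident j t = Unique-⊆⇒length≤ (incident-unique (suc t , suc j))
    (λ e∈ → let e∈edges , incident = ∈-filterᵇ⁻ e∈ in incident⊆candidates e∈edges incident)

  module _ (f : Edge → ℕ) where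

    open NarrowResolution (τ f) (k + 3)

    -- The wrong-parity test of vertexClauses is local to its where block; unification recovers it.
    vertexClauses-filter : ∀ v → ∃[ wrong ] vertexClauses f v ≡
      map (λ α → zipWith (λ e b → f e , not b) (incident v) α) (filterᵇ wrong (allBools (length (incident v))))
    vertexClauses-filter v = _ , refl

    zipWith-falseLit : ∀ ρ es → zipWith (λ e b → f e , not b) es (map ρ (map f es)) ≡ map (falseLit ρ) (map f es)
    zipWith-falseLit ρ []       = refl
    zipWith-falseLit ρ (e ∷ es) = cong (falseLit ρ (f e) ∷_) (zipWith-falseLit ρ es)

    tseitinClause : ∀ {v} → v ∈ vertices → ∀ ρ → parityOn ρ (map f (incident v)) ≡ not (charge v) →
                    map (falseLit ρ) (map f (incident v)) ∈ τ f
    tseitinClause {v} v∈ ρ violated = ∈-concatMap⁺ (vertexClauses f) (Any.map (λ { refl → ∈vertexClauses }) v∈)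
      where
      α = map ρ (map f (incident v))
      wrongParity : T (proj₁ (vertexClauses-filter v) α)
      wrongParity rewrite violated with charge v
      ... | true  = _
      ... | false = _
      α∈ : α ∈ allBools (length (incident v))
      α∈ = subst (λ n → α ∈ allBools n) (trans (length-map ρ (map f (incident v))) (length-map f (incident v)))
                 (allBools-complete α)
      ∈vertexClauses : map (falseLit ρ) (map f (incident v)) ∈ vertexClauses f v
      ∈vertexClauses = subst (_∈ vertexClauses f v) (zipWith-falseLit ρ (incident v))
                         (∈-map⁺ (λ α → zipWith (λ e b → f e , not b) (incident v) α) (∈-filterᵇ⁺ α∈ wrongParity))

    cutVars : ℕ → ℕ → List ℕ
    cutVars j t = map f (filterᵇ (crosses j t) edges)

    sweptCharge : ℕ → ℕ → Bool
    sweptCharge j t = swept j t (1 , 1)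

    Swept : ℕ → ℕ → List Clause → Set
    Swept j t cs = DerivesParity cs (cutVars j t) (sweptCharge j t)

    cutVars-start : cutVars 0 0 ≡ []
    cutVars-start = cong (map f) (filter-none (T? ∘ crosses 0 0) (All.tabulate λ e∈ → subst T (crosses-start e∈)))

    cutVars-end : cutVars N 0 ≡ []
    cutVars-end = cong (map f) (filter-none (T? ∘ crosses N 0) (All.tabulate λ e∈ → subst T (crosses-end e∈)))

    cutVars-nextColumn : ∀ j → cutVars j k ≡ cutVars (suc j) 0
    cutVars-nextColumn j = cong (map f) (filterᵇ-cong-local edges (crosses-nextColumn j))

    sweptCharge-nextColumn : ∀ j → sweptCharge j k ≡ sweptCharge (suc j) 0
    sweptCharge-nextColumn j = swept-nextColumn j {1} {1} ≤-refl (<⇒≤ 2≤k)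

    sweptCharge-end : sweptCharge N 0 ≡ true
    sweptCharge-end = swept-before {N} {0} {1} (≤-trans (m≤n+m 1 (k + c)) (≤-trans (m≤m+n r (r + 0)) (m≤n+m (2 * r) L)))

    module _ (j t : ℕ) where

      private
        v : Vertex
        v = suc t , suc j
        fresh? : ∀ e → Dec (f e ∉ cutVars j (suc t))
        fresh? e = ¬? (f e ∈? cutVars j (suc t))
        cut closed : List Edge
        cut    = filterᵇ (crosses j (suc t)) edges
        closed = filter fresh? (incident v)

      eliminated : List ℕ
      eliminated = map f closed

      eliminated-fresh : All (_∉ cutVars j (suc t)) eliminated
      eliminated-fresh = All.tabulate λ x∈ → case ∈-map⁻ f x∈ of λ where
        (e , e∈ , refl) → proj₂ (∈-filter⁻ fresh? {xs = incident v} e∈)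

      sweep-parity : ∀ ρ → parityOn ρ (cutVars j t) xor parityOn ρ (map f (incident v)) ≡ parityOn ρ (cutVars j (suc t))
      sweep-parity ρ = parityOn-filterᵇ-xor ρ f (crosses j t) (incidentTo v) (crosses j (suc t)) edges (crosses-step j t)

      oldCut⊆ : ∀ {e} → e ∈ edges → T (crosses j t e) → T (crosses j (suc t) e) ⊎ T (incidentTo v e)
      oldCut⊆ {e} e∈ crosses-old with incidentTo v e | crosses-step j t e∈
      ... | true  | _    = inj₂ _
      ... | false | step = inj₁ (subst T (sym (trans step (xor-identityʳ _))) crosses-old)

      sweep-covered : ∀ {x} → x ∈ cutVars j t ⊎ x ∈ map f (incident v) → x ∈ cutVars j (suc t) ⊎ x ∈ eliminated
      sweep-covered {x} x∈ with x ∈? cutVars j (suc t)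
      ... | yes x∈cut = inj₁ x∈cut
      ... | no  x∉cut = inj₂ (incident⇒eliminated (old⇒incident x∈))
        where
        old⇒incident : x ∈ cutVars j t ⊎ x ∈ map f (incident v) → x ∈ map f (incident v)
        old⇒incident (inj₂ x∈incident) = x∈incident
        old⇒incident (inj₁ x∈old) with ∈-map⁻ f x∈old
        ... | e , e∈ , refl with ∈-filterᵇ⁻ e∈
        ...   | e∈edges , crosses-old with oldCut⊆ e∈edges crosses-old
        ...     | inj₁ crosses-new = contradiction (∈-map⁺ f (∈-filterᵇ⁺ e∈edges crosses-new)) x∉cut
        ...     | inj₂ incident    = ∈-map⁺ f (∈-filterᵇ⁺ e∈edges incident)
        incident⇒eliminated : x ∈ map f (incident v) → x ∈ eliminated
        incident⇒eliminated x∈incident with ∈-map⁻ f x∈incident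
        ... | e , e∈ , refl = ∈-map⁺ f (∈-filter⁺ fresh? e∈ x∉cut)

      sweep-narrow : length (cutVars j (suc t)) + length eliminated ≤ k + 4
      sweep-narrow = begin
        length (cutVars j (suc t)) + length eliminated  ≡⟨ cong₂ _+_ (length-map f cut) (length-map f closed) ⟩
        length cut + length closed                      ≡⟨ length-++ cut ⟨
        length (cut ++ closed)                          ≤⟨ Unique-⊆⇒length≤ cut++closed-unique cut++closed⊆window ⟩
        length (cutCandidates j (suc t) ++ closedCandidates j t) ≤⟨ length-window j t ⟩
        k + 4                                           ∎
        where
        open ≤-Reasoning
        cut++closed-unique : Unique (cut ++ closed)
        cut++closed-unique = Unique.++⁺ (Unique.filter⁺ (T? ∘ crosses j (suc t)) edges-unique)
          (Unique.filter⁺ fresh? (incident-unique v))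
          λ (e∈cut , e∈closed) → proj₂ (∈-filter⁻ fresh? {xs = incident v} e∈closed) (∈-map⁺ f e∈cut)
        cut++closed⊆window : cut ++ closed ⊆ cutCandidates j (suc t) ++ closedCandidates j t
        cut++closed⊆window e∈ with ∈-++⁻ cut e∈
        ... | inj₁ e∈cut =
                let e∈edges , crosses-new = ∈-filterᵇ⁻ e∈cut in ∈-++⁺ˡ (crossing⊆cutCandidates e∈edges crosses-new)
        ... | inj₂ e∈closed with ∈-filter⁻ fresh? e∈closed
        ...   | e∈incident , f-e∉cut with ∈-filterᵇ⁻ e∈incident
        ...     | e∈edges , incident =
                  ∈-++⁺ʳ _ (closed⊆candidates e∈edges incident (f-e∉cut ∘ ∈-map⁺ f ∘ ∈-filterᵇ⁺ e∈edges))

      length-incidentVars : length (map f (incident v)) ≤ 4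
      length-incidentVars = ≤-trans (≤-reflexive (length-map f (incident v))) (length-incident j t)

      length-eliminated : length eliminated ≤ 4
      length-eliminated = begin
        length eliminated  ≡⟨ length-map f closed ⟩
        length closed      ≤⟨ length-filter fresh? (incident v) ⟩
        length (incident v) ≤⟨ length-incident j t ⟩
        4                  ∎
        where open ≤-Reasoning

      sweptCharge-step : sweptCharge j (suc t) ≡ sweptCharge j t xor charge v
      sweptCharge-step = trans (swept-step j t (1 , 1)) (cong (sweptCharge j t xor_) (isV-sym (1 , 1) v))

    sweepVertex : ∀ {S j t} → suc t ≤ k → suc j ≤ N → Swept j t (lines S) → Extension S (vertexCost k) (Swept j (suc t))
    sweepVertex {S} {j} {t} t<k j<N swept =
      Extension-weaken (vertexCost-bound k (length-incidentVars j t) (sweep-narrow j t) (length-eliminated j t))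
        (subst (DerivesParity _ (cutVars j (suc t))) (sym (sweptCharge-step j t)))
        (andThen (deriveAxioms (map f (incident v)) (charge v) (tseitinClause v∈) narrowIncident) λ S⊆S′ derivesIncident →
           deriveSum (sweep-parity j t) (eliminated j t) (eliminated-fresh j t) (sweep-covered j t)
                     (≤-trans (sweep-narrow j t) (≤-reflexive (+-suc k 3)))
                     (DerivesParity-mono S⊆S′ swept) derivesIncident)
      where
      v = suc t , suc j
      v∈ = vertex∈vertices (s≤s z≤n) t<k (s≤s z≤n) j<N
      narrowIncident : length (map f (incident v)) ≤ k + 3
      narrowIncident = ≤-trans (length-incidentVars j t) (≤-trans (≤-reflexive (+-comm 1 3)) (+-monoˡ-≤ 3 (<⇒≤ 2≤k)))

    sweepColumn : ∀ {S j} → suc j ≤ N → ∀ t → t ≤ k → Swept j 0 (lines S) → Extension S (t * vertexCost k) (Swept j t)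
    sweepColumn j<N zero    _   swept = unchanged swept
    sweepColumn j<N (suc t) t<k swept =
      Extension-weaken (≤-reflexive (+-comm (t * _) _)) id
        (andThen (sweepColumn j<N t (<⇒≤ t<k) swept) λ _ → sweepVertex t<k j<N)

    sweep : ∀ j → j ≤ N → Extension empty (j * (k * vertexCost k)) (Swept j 0)
    sweep zero    _   = unchanged λ ρ violated → contradiction (trans (cong (parityOn ρ) (sym cutVars-start)) violated) λ ()
    sweep (suc j) j<N =
      Extension-weaken (≤-reflexive (+-comm (j * _) _))
        (subst₂ (DerivesParity _) (cutVars-nextColumn j) (sweptCharge-nextColumn j))
        (andThen (sweep j (<⇒≤ j<N)) λ _ → sweepColumn j<N k ≤-refl)

    emptyClause : ∀ {cs} → Swept N 0 cs → [] ∈ cs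
    emptyClause swept with subst₂ (DerivesParity _) cutVars-end sweptCharge-end swept (const false) refl
    ... | []    , []∈ , _         = []∈
    ... | l ∷ D , _   , falsified with falsified (here refl)
    ...   | _ , _ , ()

    refutation : HasRefutation (τ f) (k + 3) (N * (k * vertexCost k))
    refutation with sweep N ≤-refl
    ... | extension S _ few swept = lines S , derivation S , emptyClause swept , few , narrow S

HasRefutation-mono : ∀ {F w s s′} → s ≤ s′ → HasRefutation F w s → HasRefutation F w s′
HasRefutation-mono s≤s′ (cs , derivation , []∈ , few , narrow) = cs , derivation , []∈ , ≤-trans few s≤s′ , narrow

sweepSize-bound : ∀ L r k → (L + 2 * r) * (k * vertexCost k) ≤ 544 * ((L + r) * 2 ^ k * k)
sweepSize-bound L r k = begin
  (L + 2 * r) * (k * vertexCost k)      ≤⟨ *-monoˡ-≤ (k * vertexCost k) (+-monoˡ-≤ (2 * r) (m≤m+n L (L + 0))) ⟩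
  (2 * L + 2 * r) * (k * vertexCost k)  ≡⟨ regroup L r k (2 ^ k) ⟩
  544 * ((L + r) * 2 ^ k * k)           ∎
  where
  open ≤-Reasoning
  regroup : ∀ L r k K → (2 * L + 2 * r) * (k * (272 * K)) ≡ 544 * ((L + r) * K * k)
  regroup = solve 4 (λ L r k K → (con 2 :* L :+ con 2 :* r) :* (k :* (con 272 :* K)) := con 544 :* ((L :+ r) :* K :* k)) refl

mainTheorem15 : Σ ℕ λ C →
    (k c n : ℕ) (P : ℕ → ℕ) →
    2 ≤ k → 1 ≤ c → c + 1 ≤ k → 4 * k + 2 < n →
    (∀ j → 1 ≤ j → j ≤ k → (n ≤ P j) × (P j ≤ 2 * n)) →
    (∀ i j → 1 ≤ i → i ≤ k → 1 ≤ j → j ≤ k → i ≢ j → Coprime (P i) (P j)) →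
    (f : Edge → ℕ) → Cyl.IsClassLabelling k c P f →
    HasRefutation (Cyl.τ k c P f) (k + 3) (C * ((Cyl.L k c P + Cyl.r k c P) * 2 ^ k * k))
mainTheorem15 = 544 , λ k c n P 2≤k _ _ _ _ _ f _ →
  HasRefutation-mono (sweepSize-bound (Cyl.L k c P) (Cyl.r k c P) k) (Cylinder.refutation k c P 2≤k f)
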